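{- Let $p$ be an odd prime and $q\in\{1,\ldots,(p-1)/2\}$. Then, for any $a\in\mathbb{Z}^+$ and $b\in\mathbb{N}$, the number $p^b$ is $(p^aq+1)$-universal.
   Context: For $k\in\mathbb{N}=\{0,1,2,\ldots\}$ and $m\in\mathbb{Z}^+$ let $R_m(k)=\{\binom nk \bmod m:\ n\in\mathbb{N}\}$; $m$ is called $k$-universal if $R_m(k)=\mathbb{Z}/m\mathbb{Z}$. -}

module Defs where

open import Data.Nat using (ℕ; _<_; NonZero)
open import Data.Nat.DivMod using (_%_)
open import Data.Nat.Combinatorics using (_C_)
open import Data.Product using (∃)
open import Relation.Binary.PropositionalEquality using (_≡_)

InR : (m k r : ℕ) .{{_ : NonZero m}} → Set
InR m k r = ∃ λ n → (n C k) % m ≡ r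

Universal : (k m : ℕ) .{{_ : NonZero m}} → Set
Universal k m = ∀ r → r < m → InR m k r

module Submission where

-- The proof lifts residues along the powers of p, Hensel-style.  Write P = p^a, so k = qP + 1,
-- and put  Z n = Σ_{i<q} w_i C(n, k - (i+1)P)  with weights w_i ≡ (-1)^i / (i+1)  (mod p);
-- n is liftable when p ∤ Z n.
--  * Modulo p: Lucas-type congruences give C(dP + u, k) ≡ u C(d, q) and Z(dP + u) ≡ u S d for
--    a weighted row sum S; d = q or d = q + 1 works, as S(q+1) - (q+1) S(q) ≡ -q.
--  * From p^(c+1) to p^(c+2): for M = p^(c+1+a) s, Vandermonde's identity and a Kummer-type
--    divisibility give  C(M + n, k) ≡ C(n, k) + p^(c+1) s Z n,  so a suitable s fixes the next
--    p-adic digit, while C(M + n, m) ≡ C(n, m) (mod p) for m ≤ k keeps M + n liftable.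

module BinomialUniversality where

  open import Defs using (Universal)
  open import Data.Nat as ℕ using (ℕ; zero; suc; _∸_; _≤_; _<_; z≤n; s≤s; NonZero; _^_)
  import Data.Nat.Properties as ℕP
  open import Data.Nat.DivMod using ([m+kn]%n≡m%n; m<n⇒m%n≡m; m/n*n≤m; n%1≡0)
  import Data.Nat.Divisibility as ℕD
  open import Data.Nat.Primality using (Prime; prime⇒nonZero; prime⇒nonTrivial; prime⇒irreducible; euclidsLemma)
  open import Data.Nat.Coprimality using (coprime-Bézout; prime⇒coprime)
  open import Data.Nat.GCD using (module Bézout)
  open import Data.Nat.Combinatorics using (_C_; nCk+nC[k+1]≡[n+1]C[k+1]; nCn≡1; nC1≡n; nCk≡nC[n∸k])
  open import Data.Nat.Combinatorics.Specification using (k>n⇒nCk≡0)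
  import Data.Nat.Tactic.RingSolver as NatSolver
  open import Data.Integer as ℤ using (ℤ; +_; -[1+_]; -_; 0ℤ; 1ℤ; -1ℤ; _+_; _*_; _-_)
  import Data.Integer.Properties as ℤP
  open import Data.Integer.DivMod using (a≡a%ℕn+[a/ℕn]*n; n%ℕd<d)
  open import Data.Integer.Divisibility.Signed
    using (_∣_; divides; _∣?_; ∣-refl; ∣m∣n⇒∣m+n; ∣m∣n⇒∣m-n; ∣m⇒∣-m; ∣n⇒∣m*n; ∣m⇒∣m*n; *-monoʳ-∣; ∣ᵤ⇒∣; ∣⇒∣ᵤ)
  open import Data.Integer.Tactic.RingSolver using (solve-∀)
  open import Data.Product using (∃; _,_; proj₁; proj₂; _×_)
  open import Data.Sum using (_⊎_; inj₁; inj₂)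
  open import Data.Empty using (⊥-elim)
  open import Relation.Nullary using (¬_; yes; no)
  open import Relation.Binary.Bundles using (Setoid)
  open import Relation.Binary.Definitions using (tri<; tri≈; tri>)
  open import Relation.Binary.PropositionalEquality
  open import Function using (_∘_; flip)

  Σ< : ℕ → (ℕ → ℤ) → ℤ
  Σ< zero    f = 0ℤ
  Σ< (suc n) f = Σ< n f + f n

  Σ-ext : ∀ n {f g : ℕ → ℤ} → (∀ j → j < n → f j ≡ g j) → Σ< n f ≡ Σ< n g
  Σ-ext zero    h = refl
  Σ-ext (suc n) h = cong₂ _+_ (Σ-ext n (λ j j<n → h j (ℕP.m<n⇒m<1+n j<n))) (h n (ℕP.n<1+n n))

  Σ-shift : ∀ n f → Σ< (suc n) f ≡ f 0 + Σ< n (f ∘ suc)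
  Σ-shift zero    f = ℤP.+-comm 0ℤ (f 0)
  Σ-shift (suc n) f = begin
    (Σ< n f + f n) + f (suc n)         ≡⟨ cong (_+ f (suc n)) (Σ-shift n f) ⟩
    (f 0 + Σ< n (f ∘ suc)) + f (suc n) ≡⟨ ℤP.+-assoc (f 0) _ _ ⟩
    f 0 + (Σ< n (f ∘ suc) + f (suc n)) ∎
    where open ≡-Reasoning

  Σ-+ : ∀ n f g → Σ< n (λ j → f j + g j) ≡ Σ< n f + Σ< n g
  Σ-+ zero    f g = refl
  Σ-+ (suc n) f g = trans (cong (_+ (f n + g n)) (Σ-+ n f g)) (interchange (Σ< n f) (Σ< n g) (f n) (g n))
    where
    interchange : ∀ a b c d → (a + b) + (c + d) ≡ (a + c) + (b + d)
    interchange = solve-∀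

  Σ-*ˡ : ∀ n c f → Σ< n (λ j → c * f j) ≡ c * Σ< n f
  Σ-*ˡ zero    c f = sym (ℤP.*-zeroʳ c)
  Σ-*ˡ (suc n) c f = trans (cong (_+ c * f n) (Σ-*ˡ n c f)) (sym (ℤP.*-distribˡ-+ c (Σ< n f) (f n)))

  Σ-neg : ∀ n f → Σ< n (λ i → - f i) ≡ - Σ< n f
  Σ-neg n f = trans (Σ-ext n (λ i _ → sym (ℤP.-1*i≡-i (f i)))) (trans (Σ-*ˡ n -1ℤ f) (ℤP.-1*i≡-i (Σ< n f)))

  Σ-0 : ∀ n → Σ< n (λ _ → 0ℤ) ≡ 0ℤ
  Σ-0 zero    = refl
  Σ-0 (suc n) = cong (_+ 0ℤ) (Σ-0 n)

  Σ-combination : ∀ n c f g → Σ< n (λ i → f i - c * g i) ≡ Σ< n f - c * Σ< n g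
  Σ-combination zero    c f g = sym (empty c)
    where empty : ∀ c → 0ℤ - c * 0ℤ ≡ 0ℤ
          empty = solve-∀
  Σ-combination (suc n) c f g =
    trans (cong (_+ (f n - c * g n)) (Σ-combination n c f g)) (regroup (Σ< n f) (Σ< n g) (f n) (g n) c)
    where regroup : ∀ F G x y c → (F - c * G) + (x - c * y) ≡ (F + x) - c * (G + y)
          regroup = solve-∀

  Σ-swap : ∀ n m (F : ℕ → ℕ → ℤ) → Σ< n (λ j → Σ< m (λ i → F i j)) ≡ Σ< m (λ i → Σ< n (λ j → F i j))
  Σ-swap zero    m F = sym (Σ-0 m)
  Σ-swap (suc n) m F = trans (cong (_+ Σ< m (λ i → F i n)) (Σ-swap n m F))
                             (sym (Σ-+ m (λ i → Σ< n (λ j → F i j)) (λ i → F i n)))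

  δ : ℕ → ℤ → ℕ → ℤ
  δ i₀ v i with i ℕ.≟ i₀
  ... | yes _ = v
  ... | no  _ = 0ℤ

  δ-on : ∀ i₀ v → δ i₀ v i₀ ≡ v
  δ-on i₀ v with i₀ ℕ.≟ i₀
  ... | yes _ = refl
  ... | no ne = ⊥-elim (ne refl)

  δ-off : ∀ i₀ v i → ¬ i ≡ i₀ → δ i₀ v i ≡ 0ℤ
  δ-off i₀ v i ne with i ℕ.≟ i₀
  ... | yes e = ⊥-elim (ne e)
  ... | no  _ = refl

  Σ-δ-below : ∀ n i₀ v → n ≤ i₀ → Σ< n (δ i₀ v) ≡ 0ℤ
  Σ-δ-below zero    i₀ v _   = refl
  Σ-δ-below (suc n) i₀ v n<i₀ =
    trans (cong₂ _+_ (Σ-δ-below n i₀ v (ℕP.<⇒≤ n<i₀)) (δ-off i₀ v n (ℕP.<⇒≢ n<i₀))) (ℤP.+-identityʳ 0ℤ)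

  Σ-δ : ∀ n i₀ v → i₀ < n → Σ< n (δ i₀ v) ≡ v
  Σ-δ (suc n) i₀ v i₀<1+n with n ℕ.≟ i₀
  ... | yes refl = trans (cong (_+ v) (Σ-δ-below n n v ℕP.≤-refl)) (ℤP.+-identityˡ v)
  ... | no  n≢i₀ = trans (cong (_+ 0ℤ) (Σ-δ n i₀ v i₀<n)) (ℤP.+-identityʳ v)
    where i₀<n = ℕP.≤∧≢⇒< (ℕP.≤-pred i₀<1+n) (n≢i₀ ∘ sym)

  infix 4 _≡_mod_
  record _≡_mod_ (x y d : ℤ) : Set where
    constructor ≡-mod
    field difference : d ∣ x - y

  *-distribˡ-- : ∀ c x y → c * (x - y) ≡ c * x - c * y
  *-distribˡ-- = solve-∀

  *-distribʳ-- : ∀ c x y → (x - y) * c ≡ x * c - y * c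
  *-distribʳ-- = solve-∀

  module _ {d : ℤ} where

    mod-reflexive : ∀ {x y} → x ≡ y → x ≡ y mod d
    mod-reflexive {x} refl = ≡-mod (divides 0ℤ (trans (ℤP.+-inverseʳ x) (sym (ℤP.*-zeroˡ d))))

    mod-sym : ∀ {x y} → x ≡ y mod d → y ≡ x mod d
    mod-sym {x} {y} (≡-mod h) = ≡-mod (subst (d ∣_) (negate x y) (∣m⇒∣-m h))
      where negate : ∀ x y → - (x - y) ≡ y - x
            negate = solve-∀

    mod-trans : ∀ {x y z} → x ≡ y mod d → y ≡ z mod d → x ≡ z mod d
    mod-trans {x} {y} {z} (≡-mod h) (≡-mod h′) = ≡-mod (subst (d ∣_) (telescope x y z) (∣m∣n⇒∣m+n h h′))
      where telescope : ∀ x y z → (x - y) + (y - z) ≡ x - z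
            telescope = solve-∀

    mod-setoid : Setoid _ _
    mod-setoid = record
      { Carrier       = ℤ
      ; _≈_           = λ x y → x ≡ y mod d
      ; isEquivalence = record { refl = mod-reflexive refl ; sym = mod-sym ; trans = mod-trans } }

    mod-+ : ∀ {x y u v} → x ≡ y mod d → u ≡ v mod d → x + u ≡ y + v mod d
    mod-+ {x} {y} {u} {v} (≡-mod h) (≡-mod h′) = ≡-mod (subst (d ∣_) (regroup x y u v) (∣m∣n⇒∣m+n h h′))
      where regroup : ∀ x y u v → (x - y) + (u - v) ≡ (x + u) - (y + v)
            regroup = solve-∀

    mod-neg : ∀ {x y} → x ≡ y mod d → - x ≡ - y mod d
    mod-neg {x} {y} (≡-mod h) = ≡-mod (subst (d ∣_) (regroup x y) (∣m⇒∣-m h))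
      where regroup : ∀ x y → - (x - y) ≡ (- x) - (- y)
            regroup = solve-∀

    mod-*ˡ : ∀ c {x y} → x ≡ y mod d → c * x ≡ c * y mod d
    mod-*ˡ c {x} {y} (≡-mod h) = ≡-mod (subst (d ∣_) (*-distribˡ-- c x y) (∣n⇒∣m*n c h))

    mod-*ʳ : ∀ c {x y} → x ≡ y mod d → x * c ≡ y * c mod d
    mod-*ʳ c {x} {y} (≡-mod h) = ≡-mod (subst (d ∣_) (*-distribʳ-- c x y) (∣m⇒∣m*n c h))

    mod-Σ : ∀ n {f g} → (∀ j → j < n → f j ≡ g j mod d) → Σ< n f ≡ Σ< n g mod d
    mod-Σ zero    h = mod-reflexive refl
    mod-Σ (suc n) h = mod-+ (mod-Σ n (λ j j<n → h j (ℕP.m<n⇒m<1+n j<n))) (h n (ℕP.n<1+n n))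

    ∣⇒≡0 : ∀ {x} → d ∣ x → x ≡ 0ℤ mod d
    ∣⇒≡0 {x} h = ≡-mod (subst (d ∣_) (sym (ℤP.+-identityʳ x)) h)

    ∣-resp-≡ : ∀ {x y} → x ≡ y mod d → d ∣ y → d ∣ x
    ∣-resp-≡ {x} {y} (≡-mod h) h′ = subst (d ∣_) (cancel x y) (∣m∣n⇒∣m+n h h′)
      where cancel : ∀ x y → (x - y) + y ≡ x
            cancel = solve-∀

  mod-scale : ∀ {d x y} e → x ≡ y mod d → e * x ≡ e * y mod e * d
  mod-scale {d} {x} {y} e (≡-mod h) = ≡-mod (subst (e * d ∣_) (*-distribˡ-- e x y) (*-monoʳ-∣ e h))

  mod-modulus : ∀ {d d′ x y} → d ≡ d′ → x ≡ y mod d → x ≡ y mod d′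
  mod-modulus refl x≡y = x≡y

  p^c·p≡p^[c+1] : ∀ p c → + (p ^ c) * + p ≡ + (p ^ suc c)
  p^c·p≡p^[c+1] p c = trans (sym (ℤP.pos-* (p ^ c) p)) (cong +_ (ℕP.*-comm (p ^ c) p))

  mod⇒% : ∀ m .{{_ : NonZero m}} x r → + x ≡ + r mod + m → r < m → x ℕ.% m ≡ r
  mod⇒% m x r (≡-mod (divides (+ t) x-r≡t·m)) r<m = begin
    x ℕ.% m                ≡⟨ cong (ℕ._% m) (ℤP.+-injective (trans (solve-for-x (+ x) (+ r) _ x-r≡t·m) (cong (_+_ (+ r)) (sym (ℤP.pos-* t m))))) ⟩
    (r ℕ.+ t ℕ.* m) ℕ.% m   ≡⟨ [m+kn]%n≡m%n r t m ⟩
    r ℕ.% m                ≡⟨ m<n⇒m%n≡m r<m ⟩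
    r                      ∎
    where
    open ≡-Reasoning
    solve-for-x : ∀ X R T → X - R ≡ T → X ≡ R + T
    solve-for-x X R T refl = shuffle X R
      where shuffle : ∀ X R → X ≡ R + (X - R)
            shuffle = solve-∀
  mod⇒% m x r (≡-mod (divides -[1+ t ] x-r≡-[t+1]m)) r<m = ⊥-elim (ℕP.<⇒≱ r<m m≤r)
    where
    r≡x+[t+1]m : r ≡ x ℕ.+ suc t ℕ.* m
    r≡x+[t+1]m = ℤP.+-injective (trans (solve-for-r (+ x) (+ r) (+ suc t) (+ m) x-r≡-[t+1]m)
                                      (cong (_+_ (+ x)) (sym (ℤP.pos-* (suc t) m))))
      where solve-for-r : ∀ X R T M → X - R ≡ (- T) * M → R ≡ X + T * M
            solve-for-r X R T M e = trans (shuffle X R) (trans (cong (λ z → X + - z) e) (negate X T M))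
              where shuffle : ∀ X R → R ≡ X + - (X - R)
                    shuffle = solve-∀
                    negate : ∀ X T M → X + - ((- T) * M) ≡ X + T * M
                    negate = solve-∀
    m≤r : m ≤ r
    m≤r = ℕP.≤-trans (ℕP.m≤m+n m (t ℕ.* m)) (ℕP.≤-trans (ℕP.m≤n+m (suc t ℕ.* m) x) (ℕP.≤-reflexive (sym r≡x+[t+1]m)))

  module mod-Reasoning (d : ℤ) where
    open import Relation.Binary.Reasoning.Setoid (mod-setoid {d}) public

  Σ-single : ∀ {d} n i₀ g → i₀ < n → (∀ j → j < n → ¬ j ≡ i₀ → g j ≡ 0ℤ mod d) → Σ< n g ≡ g i₀ mod d
  Σ-single {d} n i₀ g i₀<n vanish = begin
    Σ< n g              ≈⟨ mod-Σ n pointwise ⟩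
    Σ< n (δ i₀ (g i₀))  ≡⟨ Σ-δ n i₀ (g i₀) i₀<n ⟩
    g i₀                ∎
    where
    open mod-Reasoning d
    pointwise : ∀ j → j < n → g j ≡ δ i₀ (g i₀) j mod d
    pointwise j j<n with j ℕ.≟ i₀
    ... | yes refl = mod-reflexive refl
    ... | no  j≢i₀ = vanish j j<n j≢i₀

  Σ-collapse : ∀ {d} n m (ι : ℕ → ℕ) g →
    (∀ {i i′} → i < m → i′ < m → ι i ≡ ι i′ → i ≡ i′) →
    (∀ i → i < m → ι i < n) →
    (∀ j → j < n → (∃ λ i → i < m × j ≡ ι i) ⊎ ((∀ i → i < m → ¬ j ≡ ι i) × g j ≡ 0ℤ mod d)) →
    Σ< n g ≡ Σ< m (g ∘ ι) mod d
  Σ-collapse {d} n m ι g injective ι<n split = begin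
    Σ< n g                                       ≈⟨ mod-Σ n pointwise ⟩
    Σ< n (λ j → Σ< m (λ i → δ (ι i) (g (ι i)) j)) ≡⟨ Σ-swap n m (λ i → δ (ι i) (g (ι i))) ⟩
    Σ< m (λ i → Σ< n (δ (ι i) (g (ι i))))         ≡⟨ Σ-ext m (λ i i<m → Σ-δ n (ι i) (g (ι i)) (ι<n i i<m)) ⟩
    Σ< m (g ∘ ι)                                 ∎
    where
    open mod-Reasoning d
    reindex : ∀ i₀ → i₀ < m → ∀ i → i < m → δ (ι i) (g (ι i)) (ι i₀) ≡ δ i₀ (g (ι i₀)) i
    reindex i₀ i₀<m i i<m with i ℕ.≟ i₀
    ... | yes refl = δ-on (ι i) (g (ι i))
    ... | no  i≢i₀ = δ-off (ι i) _ (ι i₀) (i≢i₀ ∘ sym ∘ injective i₀<m i<m)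
    pointwise : ∀ j → j < n → g j ≡ Σ< m (λ i → δ (ι i) (g (ι i)) j) mod d
    pointwise j j<n with split j j<n
    ... | inj₁ (i₀ , i₀<m , refl) = mod-reflexive (sym (trans (Σ-ext m (reindex i₀ i₀<m)) (Σ-δ m i₀ (g (ι i₀)) i₀<m)))
    ... | inj₂ (outside , gj≡0) = mod-trans gj≡0
            (mod-reflexive (sym (trans (Σ-ext m (λ i i<m → δ-off (ι i) _ j (outside i i<m))) (Σ-0 m))))

  -- Binomial coefficients, defined by Pascal's rule so that they compute;
  -- B≡C identifies them with the library's  _C_.

  B : ℕ → ℕ → ℕ
  B n       zero    = 1
  B zero    (suc k) = 0
  B (suc n) (suc k) = B n k ℕ.+ B n (suc k)

  Bℤ : ℕ → ℕ → ℤ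
  Bℤ n k = + B n k

  B≡C : ∀ n k → B n k ≡ n C k
  B≡C n       zero    = sym (nC0≡1 n)
    where nC0≡1 : ∀ n → n C 0 ≡ 1
          nC0≡1 zero    = refl
          nC0≡1 (suc n) = refl
  B≡C zero    (suc k) = refl
  B≡C (suc n) (suc k) = trans (cong₂ ℕ._+_ (B≡C n k) (B≡C n (suc k))) (nCk+nC[k+1]≡[n+1]C[k+1] n k)

  B-above : ∀ {n k} → n < k → B n k ≡ 0
  B-above {n} {k} n<k = trans (B≡C n k) (k>n⇒nCk≡0 n<k)

  B-diag : ∀ n → B n n ≡ 1
  B-diag n = trans (B≡C n n) (nCn≡1 n)

  B-one : ∀ n → B n 1 ≡ n
  B-one n = trans (B≡C n 1) (nC1≡n n)

  B-sym : ∀ {n k} → k ≤ n → B n k ≡ B n (n ∸ k)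
  B-sym {n} {k} k≤n = trans (B≡C n k) (trans (nCk≡nC[n∸k] k≤n) (sym (B≡C n (n ∸ k))))

  B-absorb : ∀ M j → suc j ℕ.* B (suc M) (suc j) ≡ suc M ℕ.* B M j
  B-absorb zero    zero    = refl
  B-absorb zero    (suc j) =
    trans (cong (suc (suc j) ℕ.*_) (B-above {1} {suc (suc j)} (s≤s (s≤s z≤n)))) (ℕP.*-zeroʳ (suc (suc j)))
  B-absorb (suc M) zero    = trans (ℕP.+-identityʳ _) (trans (B-one (suc (suc M))) (sym (ℕP.*-identityʳ (suc (suc M)))))
  B-absorb (suc M) (suc j) = begin
    suc (suc j) ℕ.* (B (suc M) (suc j) ℕ.+ B (suc M) (suc (suc j)))
      ≡⟨ ℕP.*-distribˡ-+ (suc (suc j)) (B (suc M) (suc j)) _ ⟩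
    suc (suc j) ℕ.* B (suc M) (suc j) ℕ.+ suc (suc j) ℕ.* B (suc M) (suc (suc j))
      ≡⟨ cong₂ ℕ._+_ (cong (B (suc M) (suc j) ℕ.+_) (B-absorb M j)) (B-absorb M (suc j)) ⟩
    (B (suc M) (suc j) ℕ.+ suc M ℕ.* B M j) ℕ.+ suc M ℕ.* B M (suc j)
      ≡⟨ ℕP.+-assoc (B (suc M) (suc j)) _ _ ⟩
    B (suc M) (suc j) ℕ.+ (suc M ℕ.* B M j ℕ.+ suc M ℕ.* B M (suc j))
      ≡⟨ cong (B (suc M) (suc j) ℕ.+_) (sym (ℕP.*-distribˡ-+ (suc M) (B M j) (B M (suc j)))) ⟩
    B (suc M) (suc j) ℕ.+ suc M ℕ.* B (suc M) (suc j)
      ∎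
    where open ≡-Reasoning

  vandermonde : ∀ M n m → Bℤ (M ℕ.+ n) m ≡ Σ< (suc m) (λ j → Bℤ M j * Bℤ n (m ∸ j))
  vandermonde zero n m = sym (begin
    Σ< (suc m) (λ j → Bℤ 0 j * Bℤ n (m ∸ j))       ≡⟨ Σ-shift m _ ⟩
    1ℤ * Bℤ n m + Σ< m (λ j → 0ℤ * Bℤ n (m ∸ suc j)) ≡⟨ cong₂ _+_ (ℤP.*-identityˡ (Bℤ n m)) (Σ-0 m) ⟩
    Bℤ n m + 0ℤ                                     ≡⟨ ℤP.+-identityʳ (Bℤ n m) ⟩
    Bℤ n m                                          ∎)
    where open ≡-Reasoning
  vandermonde (suc M) n zero    = refl
  vandermonde (suc M) n (suc m) = begin
    Bℤ (M ℕ.+ n) m + Bℤ (M ℕ.+ n) (suc m)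
      ≡⟨ cong₂ _+_ (vandermonde M n m) (trans (vandermonde M n (suc m)) (Σ-shift (suc m) _)) ⟩
    S₁ + (1ℤ * Bℤ n (suc m) + S₂)
      ≡⟨ swap S₁ (1ℤ * Bℤ n (suc m)) S₂ ⟩
    1ℤ * Bℤ n (suc m) + (S₁ + S₂)
      ≡⟨ cong (_+_ (1ℤ * Bℤ n (suc m))) (trans (sym (Σ-+ (suc m) _ _)) (Σ-ext (suc m) pascal)) ⟩
    1ℤ * Bℤ n (suc m) + Σ< (suc m) (λ j → Bℤ (suc M) (suc j) * Bℤ n (m ∸ j))
      ≡⟨ sym (Σ-shift (suc m) (λ j → Bℤ (suc M) j * Bℤ n (suc m ∸ j))) ⟩
    Σ< (suc (suc m)) (λ j → Bℤ (suc M) j * Bℤ n (suc m ∸ j))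
      ∎
    where
    open ≡-Reasoning
    S₁ = Σ< (suc m) (λ j → Bℤ M j * Bℤ n (m ∸ j))
    S₂ = Σ< (suc m) (λ j → Bℤ M (suc j) * Bℤ n (m ∸ j))
    swap : ∀ a b c → a + (b + c) ≡ b + (a + c)
    swap = solve-∀
    pascal : ∀ j → j < suc m → Bℤ M j * Bℤ n (m ∸ j) + Bℤ M (suc j) * Bℤ n (m ∸ j) ≡ Bℤ (suc M) (suc j) * Bℤ n (m ∸ j)
    pascal j _ = sym (ℤP.*-distribʳ-+ (Bℤ n (m ∸ j)) (Bℤ M j) (Bℤ M (suc j)))

  sign : ℕ → ℤ
  sign zero    = 1ℤ
  sign (suc n) = - sign n

  sign-+ : ∀ m n → sign (m ℕ.+ n) ≡ sign m * sign n
  sign-+ zero    n = sym (ℤP.*-identityˡ (sign n))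
  sign-+ (suc m) n = trans (cong -_ (sign-+ m n)) (ℤP.neg-distribˡ-* (sign m) (sign n))

  sign-square : ∀ n → sign n * sign n ≡ 1ℤ
  sign-square zero    = refl
  sign-square (suc n) = trans (neg-square (sign n)) (sign-square n)
    where neg-square : ∀ x → - x * - x ≡ x * x
          neg-square = solve-∀

  sign-parity : ∀ n → (sign n ≡ 1ℤ × 2 ℕD.∣ n) ⊎ (sign n ≡ -1ℤ × 2 ℕD.∣ suc n)
  sign-parity zero = inj₁ (refl , ℕD._∣0 2)
  sign-parity (suc n) with sign-parity n
  ... | inj₁ (s≡1 , 2∣n)   = inj₂ (cong -_ s≡1 , ℕD.∣m∣n⇒∣m+n (ℕD.∣-refl {2}) 2∣n)
  ... | inj₂ (s≡-1 , 2∣1+n) = inj₁ (cong -_ s≡-1 , 2∣1+n)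

  sign-*-odd : ∀ {y} → sign y ≡ -1ℤ → ∀ x → sign (x ℕ.* y) ≡ sign x
  sign-*-odd     y-odd zero    = refl
  sign-*-odd {y} y-odd (suc x) = begin
    sign (y ℕ.+ x ℕ.* y)      ≡⟨ sign-+ y (x ℕ.* y) ⟩
    sign y * sign (x ℕ.* y)   ≡⟨ cong₂ _*_ y-odd (sign-*-odd y-odd x) ⟩
    -1ℤ * sign x              ≡⟨ ℤP.-1*i≡-i (sign x) ⟩
    - sign x                  ∎
    where open ≡-Reasoning

  sign-^-odd : ∀ {y} → sign y ≡ -1ℤ → ∀ a → sign (y ^ a) ≡ -1ℤ
  sign-^-odd     y-odd zero    = refl
  sign-^-odd {y} y-odd (suc a) = trans (sign-*-odd (sign-^-odd y-odd a) y) y-odd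

  sign-multiple-1 : ∀ {P′} → sign (suc P′) ≡ -1ℤ → ∀ i → sign (suc i ℕ.* suc P′ ∸ 1) ≡ sign i
  sign-multiple-1 {P′} P-odd i = begin
    sign (P′ ℕ.+ i ℕ.* suc P′)       ≡⟨ sign-+ P′ (i ℕ.* suc P′) ⟩
    sign P′ * sign (i ℕ.* suc P′)    ≡⟨ cong₂ _*_ P′-even (sign-*-odd P-odd i) ⟩
    1ℤ * sign i                     ≡⟨ ℤP.*-identityˡ (sign i) ⟩
    sign i                          ∎
    where
    open ≡-Reasoning
    P′-even : sign P′ ≡ 1ℤ
    P′-even = trans (sym (ℤP.neg-involutive (sign P′))) (cong -_ P-odd)

  alternating-partial : ∀ n m → Σ< (suc m) (λ j → sign j * Bℤ (suc n) j) ≡ sign m * Bℤ n m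
  alternating-partial n zero    = refl
  alternating-partial n (suc m) =
    trans (cong (_+ (- sign m * (Bℤ n m + Bℤ n (suc m)))) (alternating-partial n m))
          (telescope (sign m) (Bℤ n m) (Bℤ n (suc m)))
    where telescope : ∀ s A C → s * A + (- s) * (A + C) ≡ (- s) * C
          telescope = solve-∀

  alternating-tail : ∀ q → Σ< q (λ i → sign i * Bℤ (suc q) (suc (suc i))) ≡ + q
  alternating-tail q = isolate X (+ q) row-sum
    where
    f : ℕ → ℤ
    f j = sign j * Bℤ (suc q) j
    X = Σ< q (λ i → sign i * Bℤ (suc q) (suc (suc i)))
    row-sum : 1ℤ + (-1ℤ * (1ℤ + + q) + X) ≡ 0ℤ
    row-sum = begin
      1ℤ + (-1ℤ * (1ℤ + + q) + X)           ≡⟨ cong₂ (λ z Y → 1ℤ + (-1ℤ * (1ℤ + + z) + Y)) (sym (B-one q)) shift-sign ⟩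
      f 0 + (f 1 + Σ< q (f ∘ suc ∘ suc))     ≡⟨ cong (_+_ (f 0)) (sym (Σ-shift q (f ∘ suc))) ⟩
      f 0 + Σ< (suc q) (f ∘ suc)             ≡⟨ sym (Σ-shift (suc q) f) ⟩
      Σ< (suc (suc q)) f                     ≡⟨ alternating-partial q (suc q) ⟩
      sign (suc q) * Bℤ q (suc q)            ≡⟨ cong (λ z → sign (suc q) * + z) (B-above (ℕP.n<1+n q)) ⟩
      sign (suc q) * 0ℤ                      ≡⟨ ℤP.*-zeroʳ (sign (suc q)) ⟩
      0ℤ                                     ∎
      where
      open ≡-Reasoning
      shift-sign : X ≡ Σ< q (f ∘ suc ∘ suc)
      shift-sign = Σ-ext q (λ i _ → cong (_* Bℤ (suc q) (suc (suc i))) (sym (ℤP.neg-involutive (sign i))))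
    isolate : ∀ X Q → 1ℤ + (-1ℤ * (1ℤ + Q) + X) ≡ 0ℤ → X ≡ Q
    isolate X Q h = trans (expand X Q) (trans (cong (_+ Q) h) (ℤP.+-identityˡ Q))
      where expand : ∀ X Q → X ≡ (1ℤ + (-1ℤ * (1ℤ + Q) + X)) + Q
            expand = solve-∀

  symmetric-absorption : ∀ q i → suc i ≤ q →
    Bℤ (suc q) (q ∸ suc i) - + suc q * Bℤ q (q ∸ suc i) ≡ - (+ suc i * Bℤ (suc q) (suc (suc i)))
  symmetric-absorption q i i<q = begin
    Bℤ (suc q) (q ∸ suc i) - + suc q * Bℤ q (q ∸ suc i)
      ≡⟨ cong₂ (λ u v → + u - + suc q * + v) reflect-upper (sym (B-sym i<q)) ⟩
    C′ - + suc q * Bℤ q (suc i)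
      ≡⟨ cong (λ z → C′ - z) absorb ⟩
    C′ - (1ℤ + (1ℤ + + i)) * C′
      ≡⟨ collect C′ (+ i) ⟩
    - (+ suc i * C′)
      ∎
    where
    open ≡-Reasoning
    C′ = Bℤ (suc q) (suc (suc i))
    reflect-upper : B (suc q) (q ∸ suc i) ≡ B (suc q) (suc (suc i))
    reflect-upper = trans (B-sym (ℕP.≤-trans (ℕP.m∸n≤m q (suc i)) (ℕP.n≤1+n q)))
                          (cong (B (suc q)) (trans (ℕP.+-∸-assoc 1 (ℕP.m∸n≤m q (suc i))) (cong suc (ℕP.m∸[m∸n]≡n i<q))))
    absorb : + suc q * Bℤ q (suc i) ≡ (1ℤ + (1ℤ + + i)) * C′
    absorb = trans (sym (ℤP.pos-* (suc q) (B q (suc i))))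
                   (trans (cong +_ (sym (B-absorb q (suc i)))) (ℤP.pos-* (suc (suc i)) (B (suc q) (suc (suc i)))))
    collect : ∀ C I → C - (1ℤ + (1ℤ + I)) * C ≡ - ((1ℤ + I) * C)
    collect = solve-∀

  module ModPrime (p : ℕ) (p-prime : Prime p) where

    instance
      p≢0 : NonZero p
      p≢0 = prime⇒nonZero p-prime

    residue : ∀ z → ∃ λ u → u < p × z ≡ + u mod + p
    residue z = z ℤ.%ℕ p , n%ℕd<d z p , ≡-mod (divides (z ℤ./ℕ p) (difference (a≡a%ℕn+[a/ℕn]*n z p)))
      where difference : ∀ {z r t} → z ≡ r + t → z - r ≡ t
            difference {r = r} {t} refl = cancel-left r t
              where cancel-left : ∀ r t → (r + t) - r ≡ t
                    cancel-left = solve-∀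

    p∤small : ∀ {u} → 0 < u → u < p → ¬ + p ∣ + u
    p∤small {suc u} _ u<p p∣u = ℕD.>⇒∤ u<p (∣⇒∣ᵤ p∣u)

    p∤1 : ¬ + p ∣ 1ℤ
    p∤1 = p∤small (s≤s z≤n) (ℕP.≤-trans (s≤s (s≤s z≤n)) (prime⇒≥2 p-prime))
      where prime⇒≥2 : Prime p → 2 ≤ p
            prime⇒≥2 pr = ℕ.nonTrivial⇒n>1 p {{prime⇒nonTrivial pr}}

    euclid : ∀ x y → + p ∣ x * y → + p ∣ x ⊎ + p ∣ y
    euclid x y p∣xy with euclidsLemma ℤ.∣ x ∣ ℤ.∣ y ∣ p-prime (subst (p ℕD.∣_) (ℤP.abs-* x y) (∣⇒∣ᵤ p∣xy))
    ... | inj₁ p∣x = inj₁ (∣ᵤ⇒∣ p∣x)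
    ... | inj₂ p∣y = inj₂ (∣ᵤ⇒∣ p∣y)

    p∤* : ∀ {x y} → ¬ + p ∣ x → ¬ + p ∣ y → ¬ + p ∣ x * y
    p∤* {x} {y} p∤x p∤y p∣xy with euclid x y p∣xy
    ... | inj₁ p∣x = p∤x p∣x
    ... | inj₂ p∣y = p∤y p∣y

    cancel : ∀ c {x y} → ¬ + p ∣ c → c * x ≡ c * y mod + p → x ≡ y mod + p
    cancel c {x} {y} p∤c (≡-mod p∣cx-cy) with euclid c (x - y) (subst (+ p ∣_) (sym (*-distribˡ-- c x y)) p∣cx-cy)
    ... | inj₁ p∣c     = ⊥-elim (p∤c p∣c)
    ... | inj₂ p∣x-y   = ≡-mod p∣x-y

    inverse : ∀ z → ¬ + p ∣ z → ∃ λ w → w * z ≡ 1ℤ mod + p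
    inverse z p∤z with residue z
    ... | zero  , _   , z≡0 = ⊥-elim (p∤z (∣-resp-≡ z≡0 (divides 0ℤ refl)))
    ... | suc u , u<p , z≡u with coprime-Bézout (prime⇒coprime p-prime u<p)
    ... | Bézout.+- x y eq = - + y , mod-trans (mod-*ˡ (- + y) z≡u) (≡-mod (divides (- + x) (rearrange (lift eq))))
      where
      lift : 1 ℕ.+ y ℕ.* suc u ≡ x ℕ.* p → 1ℤ + + y * + suc u ≡ + x * + p
      lift e = trans (cong (_+_ 1ℤ) (sym (ℤP.pos-* y (suc u)))) (trans (cong +_ e) (ℤP.pos-* x p))
      rearrange : 1ℤ + + y * + suc u ≡ + x * + p → - + y * + suc u - 1ℤ ≡ - + x * + p
      rearrange e = trans (negate (+ y) (+ suc u)) (trans (cong -_ e) (ℤP.neg-distribˡ-* (+ x) (+ p)))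
        where negate : ∀ Y U → - Y * U - 1ℤ ≡ - (1ℤ + Y * U)
              negate = solve-∀
    ... | Bézout.-+ x y eq = + y , mod-trans (mod-*ˡ (+ y) z≡u) (≡-mod (divides (+ x) (rearrange (lift eq))))
      where
      lift : 1 ℕ.+ x ℕ.* p ≡ y ℕ.* suc u → 1ℤ + + x * + p ≡ + y * + suc u
      lift e = trans (cong (_+_ 1ℤ) (sym (ℤP.pos-* x p))) (trans (cong +_ e) (ℤP.pos-* y (suc u)))
      rearrange : 1ℤ + + x * + p ≡ + y * + suc u → + y * + suc u - 1ℤ ≡ + x * + p
      rearrange e = trans (cong (_- 1ℤ) (sym e)) (cancel-1 (+ x * + p))
        where cancel-1 : ∀ X → (1ℤ + X) - 1ℤ ≡ X
              cancel-1 = solve-∀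

    solve : ∀ z t → ¬ + p ∣ z → ∃ λ s → + s * z ≡ t mod + p
    solve z t p∤z with inverse z p∤z
    ... | w , wz≡1 with residue (t * w)
    ... | s , _ , tw≡s = s , (begin
      + s * z      ≈⟨ mod-*ʳ z (mod-sym tw≡s) ⟩
      t * w * z    ≡⟨ ℤP.*-assoc t w z ⟩
      t * (w * z)  ≈⟨ mod-*ˡ t wz≡1 ⟩
      t * 1ℤ       ≡⟨ ℤP.*-identityʳ t ⟩
      t            ∎)
      where open mod-Reasoning (+ p)

    -- The quotient t / z in ℤ/pℤ, as a total function; it is correct when p ∤ z.
    ratio : ℤ → ℤ → ℕ
    ratio t z with + p ∣? z
    ... | yes _   = 0
    ... | no  p∤z = proj₁ (solve z t p∤z)

    ratio-spec : ∀ t z → ¬ + p ∣ z → + ratio t z * z ≡ t mod + p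
    ratio-spec t z p∤z with + p ∣? z
    ... | yes p∣z  = ⊥-elim (p∤z p∣z)
    ... | no  p∤z′ = proj₂ (solve z t p∤z′)

    p∤sign : ∀ n → ¬ + p ∣ sign n
    p∤sign n p∣sign = p∤1 (subst (+ p ∣_) (sign-square n) (∣m⇒∣m*n (sign n) p∣sign))

    odd-prime-sign : ¬ p ≡ 2 → sign p ≡ -1ℤ
    odd-prime-sign p≢2 with sign-parity p
    ... | inj₂ (sign≡-1 , _) = sign≡-1
    ... | inj₁ (_ , 2∣p) with prime⇒irreducible p-prime 2∣p
    ...   | inj₁ ()
    ...   | inj₂ 2≡p = ⊥-elim (p≢2 (sym 2≡p))

  ^-monoʳ-∣ : ∀ m {a b} → a ≤ b → m ^ a ℕD.∣ m ^ b
  ^-monoʳ-∣ m {a} {b} a≤b = ℕD.divides (m ^ (b ∸ a)) (begin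
    m ^ b                ≡⟨ cong (m ^_) (sym (ℕP.m+[n∸m]≡n a≤b)) ⟩
    m ^ (a ℕ.+ (b ∸ a))  ≡⟨ ℕP.^-distribˡ-+-* m a (b ∸ a) ⟩
    m ^ a ℕ.* m ^ (b ∸ a) ≡⟨ ℕP.*-comm (m ^ a) _ ⟩
    m ^ (b ∸ a) ℕ.* m ^ a ∎)
    where open ≡-Reasoning

  module PrimePowers (p : ℕ) (p-prime : Prime p) where

    instance
      p≢0 : NonZero p
      p≢0 = prime⇒nonZero p-prime

    pow-cancel-coprime : ∀ n {j x} → ¬ p ℕD.∣ j → p ^ n ℕD.∣ j ℕ.* x → p ^ n ℕD.∣ x
    pow-cancel-coprime zero    {x = x} _ _ = ℕD.1∣ x
    pow-cancel-coprime (suc n) {j} {x} p∤j pⁿ⁺¹∣jx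
      with euclidsLemma j x p-prime (ℕD.∣-trans (ℕD.m∣m*n (p ^ n)) pⁿ⁺¹∣jx)
    ... | inj₁ p∣j = ⊥-elim (p∤j p∣j)
    ... | inj₂ (ℕD.divides x′ refl) = subst (p ^ suc n ℕD.∣_) (ℕP.*-comm p x′) (ℕD.*-monoʳ-∣ p pⁿ∣x′)
      where
      pⁿ∣jx′ : p ^ n ℕD.∣ j ℕ.* x′
      pⁿ∣jx′ = ℕD.*-cancelˡ-∣ p (subst (p ^ suc n ℕD.∣_) (rearrange j x′ p) pⁿ⁺¹∣jx)
        where rearrange : ∀ j x p → j ℕ.* (x ℕ.* p) ≡ p ℕ.* (j ℕ.* x)
              rearrange = NatSolver.solve-∀
      pⁿ∣x′ = pow-cancel-coprime n p∤j pⁿ∣jx′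

    pow-cancel : ∀ e a {j x} → p ^ (e ℕ.+ a) ℕD.∣ j ℕ.* x → ¬ p ^ a ℕD.∣ j → p ^ suc e ℕD.∣ x
    pow-cancel e zero    {j} _ p⁰∤j = ⊥-elim (p⁰∤j (ℕD.1∣ j))
    pow-cancel e (suc a) {j} {x} pᵉ⁺ᵃ∣jx pᵃ∤j with p ℕD.∣? j
    ... | no  p∤j = ℕD.∣-trans (^-monoʳ-∣ p (subst (suc e ≤_) (sym (ℕP.+-suc e a)) (s≤s (ℕP.m≤m+n e a))))
                      (pow-cancel-coprime (e ℕ.+ suc a) p∤j pᵉ⁺ᵃ∣jx)
    ... | yes (ℕD.divides j′ refl) = pow-cancel e a pᵉ⁺ᵃ∣j′x pᵃ∤j′
      where
      pᵉ⁺ᵃ∣j′x : p ^ (e ℕ.+ a) ℕD.∣ j′ ℕ.* x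
      pᵉ⁺ᵃ∣j′x = ℕD.*-cancelˡ-∣ p (subst₂ ℕD._∣_ (cong (p ^_) (ℕP.+-suc e a)) (rearrange j′ p x) pᵉ⁺ᵃ∣jx)
        where rearrange : ∀ j p x → j ℕ.* p ℕ.* x ≡ p ℕ.* (j ℕ.* x)
              rearrange = NatSolver.solve-∀
      pᵃ∤j′ : ¬ p ^ a ℕD.∣ j′
      pᵃ∤j′ pᵃ∣j′ = pᵃ∤j (subst (p ^ suc a ℕD.∣_) (ℕP.*-comm p j′) (ℕD.*-monoʳ-∣ p pᵃ∣j′))

    -- Kummer-type bound, via  j C(M, j) = M C(M-1, j-1).
    binomial-divisible : ∀ e a M j → p ^ (e ℕ.+ a) ℕD.∣ M → 0 < j → ¬ p ^ a ℕD.∣ j → p ^ suc e ℕD.∣ B M j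
    binomial-divisible e a zero    (suc j) _   _ _    = ℕD._∣0 _
    binomial-divisible e a (suc M) (suc j) p∣M _ pᵃ∤j =
      pow-cancel e a (subst (p ^ (e ℕ.+ a) ℕD.∣_) (sym (B-absorb M j)) (ℕD.∣-trans p∣M (ℕD.m∣m*n (B M j)))) pᵃ∤j

    p∣binomial : ∀ a M j → p ^ a ℕD.∣ M → 0 < j → ¬ p ^ a ℕD.∣ j → + p ∣ Bℤ M j
    p∣binomial a M j pᵃ∣M j>0 pᵃ∤j =
      ∣ᵤ⇒∣ (subst (ℕD._∣ B M j) (ℕP.*-identityʳ p) (binomial-divisible 0 a M j pᵃ∣M j>0 pᵃ∤j))

    row-below-multiple : ∀ N M j → p ^ N ℕD.∣ suc M → j < p ^ N → Bℤ M j ≡ sign j mod + p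
    row-below-multiple N M zero    _      _       = mod-reflexive refl
    row-below-multiple N M (suc j) pᴺ∣M+1 j+1<pᴺ = begin
      Bℤ M (suc j)                              ≡⟨ pascal (Bℤ M j) (Bℤ M (suc j)) ⟩
      Bℤ (suc M) (suc j) + - Bℤ M j             ≈⟨ mod-+ (∣⇒≡0 p∣C) (mod-neg (row-below-multiple N M j pᴺ∣M+1 j<pᴺ)) ⟩
      0ℤ + - sign j                             ≡⟨ ℤP.+-identityˡ (- sign j) ⟩
      sign (suc j)                              ∎
      where
      open mod-Reasoning (+ p)
      pascal : ∀ x y → y ≡ (x + y) + - x
      pascal = solve-∀
      j<pᴺ = ℕP.<-trans (ℕP.n<1+n j) j+1<pᴺ
      p∣C : + p ∣ Bℤ (suc M) (suc j)
      p∣C = p∣binomial N (suc M) (suc j) pᴺ∣M+1 (s≤s z≤n) (λ pᴺ∣j+1 → ℕP.<⇒≱ j+1<pᴺ (ℕD.∣⇒≤ pᴺ∣j+1))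

  -- The universality argument for  k = p^a q + 1.

  module Universality (p : ℕ) (p-prime : Prime p) (p-odd : sign p ≡ -1ℤ)
                      (q : ℕ) (1≤q : 1 ≤ q) (q+1<p : suc q < p) (a : ℕ) (1≤a : 1 ≤ a) where

    open ModPrime p p-prime
    open PrimePowers p p-prime hiding (p≢0)

    P : ℕ
    P = p ^ a

    k : ℕ
    k = P ℕ.* q ℕ.+ 1

    instance
      P≢0 : NonZero P
      P≢0 = ℕP.m^n≢0 p a

    p≤P : p ≤ P
    p≤P = subst (λ e → p ≤ p ^ e) (ℕP.m+[n∸m]≡n 1≤a) (ℕP.m≤m*n p (p ^ (a ∸ 1)) {{ℕP.m^n≢0 p (a ∸ 1)}})

    2≤P : 2 ≤ P
    2≤P = ℕP.≤-trans (ℕ.nonTrivial⇒n>1 p {{prime⇒nonTrivial p-prime}}) p≤P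

    0<P : 0 < P
    0<P = ℕP.<-trans (s≤s z≤n) 2≤P

    P≤multiple : ∀ {x} → 1 ≤ x → P ≤ x ℕ.* P
    P≤multiple {x} 1≤x = subst (_≤ x ℕ.* P) (ℕP.*-identityˡ P) (ℕP.*-monoˡ-≤ P 1≤x)

    multiple-index-≤ : ∀ i₀ e → i₀ ℕ.* P ≤ suc (e ℕ.* P) → i₀ ≤ e
    multiple-index-≤ i₀ e i₀P≤eP+1 with i₀ ℕ.≤? e
    ... | yes i₀≤e = i₀≤e
    ... | no  i₀≰e = ⊥-elim (ℕP.<⇒≱ eP+1<i₀P i₀P≤eP+1)
      where eP+1<i₀P = ℕP.≤-trans (ℕP.+-monoˡ-≤ (e ℕ.* P) 2≤P) (ℕP.*-monoˡ-≤ P (ℕP.≰⇒> i₀≰e))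

    k≡1+qP : k ≡ suc (q ℕ.* P)
    k≡1+qP = trans (ℕP.+-comm (P ℕ.* q) 1) (cong suc (ℕP.*-comm P q))

    k<p^[a+1] : k < p ^ suc a
    k<p^[a+1] = begin-strict
      P ℕ.* q ℕ.+ 1    <⟨ ℕP.+-monoʳ-< (P ℕ.* q) 2≤P ⟩
      P ℕ.* q ℕ.+ P    ≡⟨ trans (ℕP.+-comm (P ℕ.* q) P) (sym (ℕP.*-suc P q)) ⟩
      P ℕ.* suc q      ≤⟨ ℕP.*-monoʳ-≤ P (ℕP.<⇒≤ q+1<p) ⟩
      P ℕ.* p          ≡⟨ ℕP.*-comm P p ⟩
      p ^ suc a        ∎
      where open ℕP.≤-Reasoning

    -- The lower indices  κ i = k - (i+1) P  paired with the multiples (i+1) P in Vandermonde's sum.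
    κ : ℕ → ℕ
    κ i = suc ((q ∸ suc i) ℕ.* P)

    k∸[i+1]P≡κ : ∀ i → i < q → k ∸ suc i ℕ.* P ≡ κ i
    k∸[i+1]P≡κ i i<q = begin
      k ∸ suc i ℕ.* P                ≡⟨ cong (_∸ suc i ℕ.* P) k≡1+qP ⟩
      suc (q ℕ.* P) ∸ suc i ℕ.* P    ≡⟨ ℕP.+-∸-assoc 1 (ℕP.*-monoˡ-≤ P i<q) ⟩
      suc (q ℕ.* P ∸ suc i ℕ.* P)    ≡⟨ cong suc (sym (ℕP.*-distribʳ-∸ P q (suc i))) ⟩
      κ i                            ∎
      where open ≡-Reasoning

    κ≤k : ∀ i → i < q → κ i ≤ k
    κ≤k i i<q = subst (_≤ k) (k∸[i+1]P≡κ i i<q) (ℕP.m∸n≤m k (suc i ℕ.* P))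

    -- Weights  w_i ≡ (-1)^i / (i+1)  (mod p), for i < q; they exist because i + 1 < p.
    p∤i+1 : ∀ i → i < q → ¬ + p ∣ + suc i
    p∤i+1 i i<q = p∤small (s≤s z≤n) (ℕP.≤-trans (s≤s i<q) (ℕP.<⇒≤ q+1<p))

    weight : ℕ → ℕ
    weight i = ratio (sign i) (+ suc i)

    weight-spec : ∀ i → i < q → + weight i * + suc i ≡ sign i mod + p
    weight-spec i i<q = ratio-spec (sign i) (+ suc i) (p∤i+1 i i<q)

    -- Z n is, modulo p, the coefficient of p^c s in  C(n + p^(a+c) s, k) - C(n, k);
    -- n is liftable when this coefficient is a unit.
    Z : ℕ → ℤ
    Z n = Σ< q (λ i → + weight i * Bℤ n (κ i))

    Liftable : ℕ → Set
    Liftable n = ¬ + p ∣ Z n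

    stable-mod-p : ∀ M n m → p ^ suc a ℕD.∣ M → m ≤ k → Bℤ (M ℕ.+ n) m ≡ Bℤ n m mod + p
    stable-mod-p M n m pᵃ⁺¹∣M m≤k = begin
      Bℤ (M ℕ.+ n) m                              ≡⟨ vandermonde M n m ⟩
      Σ< (suc m) (λ j → Bℤ M j * Bℤ n (m ∸ j))     ≈⟨ Σ-single (suc m) 0 _ (s≤s z≤n) vanish ⟩
      1ℤ * Bℤ n m                                 ≡⟨ ℤP.*-identityˡ (Bℤ n m) ⟩
      Bℤ n m                                      ∎
      where
      open mod-Reasoning (+ p)
      vanish : ∀ j → j < suc m → ¬ j ≡ 0 → Bℤ M j * Bℤ n (m ∸ j) ≡ 0ℤ mod + p
      vanish zero    _       0≢0 = ⊥-elim (0≢0 refl)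
      vanish (suc j) j<m+1   _   = ∣⇒≡0 (∣m⇒∣m*n _ (p∣binomial (suc a) M (suc j) pᵃ⁺¹∣M (s≤s z≤n) pᵃ⁺¹∤j+1))
        where
        j+1<p^[a+1] = ℕP.≤-<-trans (ℕP.≤-trans (ℕP.≤-pred j<m+1) m≤k) k<p^[a+1]
        pᵃ⁺¹∤j+1 = λ pᵃ⁺¹∣j+1 → ℕP.<⇒≱ j+1<p^[a+1] (ℕD.∣⇒≤ pᵃ⁺¹∣j+1)

    liftable-stable : ∀ M n → p ^ suc a ℕD.∣ M → Liftable n → Liftable (M ℕ.+ n)
    liftable-stable M n pᵃ⁺¹∣M n-liftable p∣Z = n-liftable (∣-resp-≡ (mod-sym Z-stable) p∣Z)
      where Z-stable = mod-Σ q (λ i i<q → mod-*ˡ (+ weight i) (stable-mod-p M n (κ i) pᵃ⁺¹∣M (κ≤k i i<q)))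

    -- Lucas-type congruences for the base P = p^a:  C(dP, eP) ≡ C(d, e).  Expanding
    -- C(P + dP, m) by Vandermonde, only the terms j = 0 and j = P survive modulo p.
    lucas-multiple : ∀ d e → Bℤ (d ℕ.* P) (e ℕ.* P) ≡ Bℤ d e mod + p
    lucas-multiple zero    zero    = mod-reflexive refl
    lucas-multiple zero    (suc e) = mod-reflexive (cong +_ (B-above (ℕP.<-≤-trans 0<P (ℕP.m≤m+n P (e ℕ.* P)))))
    lucas-multiple (suc d) zero    = mod-reflexive refl
    lucas-multiple (suc d) (suc e) = begin
      Bℤ (P ℕ.+ d ℕ.* P) m                                  ≡⟨ vandermonde P (d ℕ.* P) m ⟩
      Σ< (suc m) g                                          ≈⟨ Σ-collapse (suc m) 2 (ℕ._* P) g injective ι<m+1 split ⟩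
      (0ℤ + g 0) + g (P ℕ.+ 0)                               ≡⟨ cong₂ _+_ (ℤP.+-identityˡ (g 0)) (cong g (ℕP.+-identityʳ P)) ⟩
      1ℤ * Bℤ (d ℕ.* P) m + Bℤ P P * Bℤ (d ℕ.* P) (m ∸ P)    ≡⟨ cong₂ _+_ (ℤP.*-identityˡ (Bℤ (d ℕ.* P) m)) top-term ⟩
      Bℤ (d ℕ.* P) m + Bℤ (d ℕ.* P) (e ℕ.* P)               ≈⟨ mod-+ (lucas-multiple d (suc e)) (lucas-multiple d e) ⟩
      Bℤ d (suc e) + Bℤ d e                                 ≡⟨ ℤP.+-comm (Bℤ d (suc e)) (Bℤ d e) ⟩
      Bℤ (suc d) (suc e)                                    ∎
      where
      open mod-Reasoning (+ p)
      m = suc e ℕ.* P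
      g : ℕ → ℤ
      g j = Bℤ P j * Bℤ (d ℕ.* P) (m ∸ j)
      top-term : Bℤ P P * Bℤ (d ℕ.* P) (m ∸ P) ≡ Bℤ (d ℕ.* P) (e ℕ.* P)
      top-term = trans (cong₂ (λ u v → + u * Bℤ (d ℕ.* P) v) (B-diag P) (ℕP.m+n∸m≡n P (e ℕ.* P))) (ℤP.*-identityˡ _)
      injective : ∀ {i i′} → i < 2 → i′ < 2 → i ℕ.* P ≡ i′ ℕ.* P → i ≡ i′
      injective {i} {i′} _ _ = ℕP.*-cancelʳ-≡ i i′ P
      ι<m+1 : ∀ i → i < 2 → i ℕ.* P < suc m
      ι<m+1 i i<2 = s≤s (ℕP.*-monoˡ-≤ P (ℕP.≤-trans (ℕP.≤-pred i<2) (s≤s (z≤n {e}))))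
      outside : ∀ {j} → ¬ j ≡ 0 → ¬ j ≡ P → ∀ i → i < 2 → ¬ j ≡ i ℕ.* P
      outside j≢0 j≢P zero          _ = j≢0
      outside j≢0 j≢P (suc zero)    _ = j≢P ∘ flip trans (ℕP.+-identityʳ P)
      outside j≢0 j≢P (suc (suc i)) (s≤s (s≤s ()))
      split : ∀ j → j < suc m → (∃ λ i → i < 2 × j ≡ i ℕ.* P) ⊎ ((∀ i → i < 2 → ¬ j ≡ i ℕ.* P) × g j ≡ 0ℤ mod + p)
      split j _ with ℕP.<-cmp j P | j ℕ.≟ 0
      ... | _              | yes refl = inj₁ (0 , s≤s z≤n , refl)
      ... | tri≈ _ refl _  | no  _    = inj₁ (1 , ℕP.≤-refl , sym (ℕP.+-identityʳ P))
      ... | tri< j<P j≢P _ | no  j≢0  = inj₂ (outside j≢0 j≢P , ∣⇒≡0 (∣m⇒∣m*n _ p∣C))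
        where p∣C = p∣binomial a P j ℕD.∣-refl (ℕP.n≢0⇒n>0 j≢0) (λ P∣j → ℕP.<⇒≱ j<P (ℕD.∣⇒≤ {{ℕ.≢-nonZero j≢0}} P∣j))
      ... | tri> _ j≢P P<j | no  j≢0  =
        inj₂ (outside j≢0 j≢P , mod-reflexive (trans (cong (λ t → + t * Bℤ (d ℕ.* P) (m ∸ j)) (B-above P<j)) (ℤP.*-zeroˡ (Bℤ (d ℕ.* P) (m ∸ j)))))

    -- C(dP + c, eP + 1) ≡ c C(d, e) for c < p: only the term j = eP of Vandermonde's sum survives.
    lucas-shifted : ∀ d c e → c < p → Bℤ (d ℕ.* P ℕ.+ c) (suc (e ℕ.* P)) ≡ + c * Bℤ d e mod + p
    lucas-shifted d c e c<p = begin
      Bℤ (d ℕ.* P ℕ.+ c) m                              ≡⟨ vandermonde (d ℕ.* P) c m ⟩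
      Σ< (suc m) g                                      ≈⟨ Σ-single (suc m) (e ℕ.* P) g (s≤s (ℕP.n≤1+n _)) vanish ⟩
      Bℤ (d ℕ.* P) (e ℕ.* P) * Bℤ c (m ∸ e ℕ.* P)        ≡⟨ cong (λ t → Bℤ (d ℕ.* P) (e ℕ.* P) * + t) C[c,1]≡c ⟩
      Bℤ (d ℕ.* P) (e ℕ.* P) * + c                      ≈⟨ mod-*ʳ (+ c) (lucas-multiple d e) ⟩
      Bℤ d e * + c                                      ≡⟨ ℤP.*-comm (Bℤ d e) (+ c) ⟩
      + c * Bℤ d e                                      ∎
      where
      open mod-Reasoning (+ p)
      m = suc (e ℕ.* P)
      g : ℕ → ℤ
      g j = Bℤ (d ℕ.* P) j * Bℤ c (m ∸ j)
      C[c,1]≡c : B c (m ∸ e ℕ.* P) ≡ c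
      C[c,1]≡c = trans (cong (B c) (ℕP.m+n∸n≡m 1 (e ℕ.* P))) (B-one c)
      vanish : ∀ j → j < suc m → ¬ j ≡ e ℕ.* P → g j ≡ 0ℤ mod + p
      vanish j j<m+1 j≢eP with P ℕD.∣? j
      ... | no P∤j = ∣⇒≡0 (∣m⇒∣m*n _ (p∣binomial a (d ℕ.* P) j (ℕD.n∣m*n d) 0<j P∤j))
        where 0<j = ℕP.n≢0⇒n>0 (λ j≡0 → P∤j (subst (P ℕD.∣_) (sym j≡0) (ℕD._∣0 P)))
      ... | yes (ℕD.divides i₀ refl) =
        mod-reflexive (trans (cong (λ t → Bℤ (d ℕ.* P) (i₀ ℕ.* P) * + t) (B-above c<m∸j)) (ℤP.*-zeroʳ (Bℤ (d ℕ.* P) (i₀ ℕ.* P))))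
        where
        i₀<e : i₀ < e
        i₀<e = ℕP.≤∧≢⇒< (multiple-index-≤ i₀ e (ℕP.≤-pred j<m+1)) (λ i₀≡e → j≢eP (cong (ℕ._* P) i₀≡e))
        c<m∸j : c < m ∸ i₀ ℕ.* P
        -- c < p ≤ P, so  c + 1 + i₀ P ≤ (i₀ + 1) P ≤ e P < m.
        c<m∸j = ℕP.m+n≤o⇒m≤o∸n (suc c)
          (ℕP.≤-trans (ℕP.+-monoˡ-≤ (i₀ ℕ.* P) (ℕP.≤-trans c<p p≤P))
          (ℕP.≤-trans (ℕP.*-monoˡ-≤ P i₀<e) (ℕP.n≤1+n (e ℕ.* P))))

    C[1,k]≡0 : B 1 k ≡ 0
    C[1,k]≡0 = B-above (subst (1 <_) (sym k≡1+qP) (s≤s (ℕP.<-≤-trans 0<P (P≤multiple 1≤q))))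

    liftable-1 : Liftable 1
    liftable-1 p∣Z₁ = p∤sign (q ∸ 1) (∣-resp-≡ (mod-sym (weight-spec (q ∸ 1) q∸1<q)) (∣m⇒∣m*n _ p∣w))
      where
      q∸1<q = subst (q ∸ 1 <_) (ℕP.m+[n∸m]≡n 1≤q) (ℕP.n<1+n (q ∸ 1))
      -- only the term i = q-1, where κ i = 1, survives in Z 1
      κ[q-1]≡1 : κ (q ∸ 1) ≡ 1
      κ[q-1]≡1 = trans (cong (λ t → suc ((q ∸ t) ℕ.* P)) (ℕP.m+[n∸m]≡n 1≤q)) (cong (λ t → suc (t ℕ.* P)) (ℕP.n∸n≡0 q))
      vanish : ∀ i → i < q → ¬ i ≡ q ∸ 1 → + weight i * Bℤ 1 (κ i) ≡ 0ℤ mod + p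
      vanish i i<q i≢q-1 = mod-reflexive (trans (cong (λ t → + weight i * + t) (B-above 1<κ)) (ℤP.*-zeroʳ (+ weight i)))
        where
        i+1<q = ℕP.≤∧≢⇒< i<q (λ i+1≡q → i≢q-1 (cong ℕ.pred i+1≡q))
        1<κ = s≤s (ℕP.<-≤-trans 0<P (P≤multiple (ℕP.m+n≤o⇒m≤o∸n 1 i+1<q)))
      p∣w : + p ∣ + weight (q ∸ 1)
      p∣w = ∣-resp-≡ (mod-sym (begin
        Z 1                                            ≈⟨ Σ-single q (q ∸ 1) _ q∸1<q vanish ⟩
        + weight (q ∸ 1) * Bℤ 1 (κ (q ∸ 1))             ≡⟨ cong (λ t → + weight (q ∸ 1) * Bℤ 1 t) κ[q-1]≡1 ⟩
        + weight (q ∸ 1) * 1ℤ                           ≡⟨ ℤP.*-identityʳ _ ⟩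
        + weight (q ∸ 1)                                ∎)) p∣Z₁
        where open mod-Reasoning (+ p)

    -- Base case, residues prime to p: take n = d P + u.  By the Lucas-type congruences
    -- C(n, k) ≡ u C(d, q) and Z n ≡ u S d, where S d is the following weighted row sum.
    S : ℕ → ℤ
    S d = Σ< q (λ i → + weight i * Bℤ d (q ∸ suc i))

    Z-lucas : ∀ d u → u < p → Z (d ℕ.* P ℕ.+ u) ≡ + u * S d mod + p
    Z-lucas d u u<p = begin
      Z (d ℕ.* P ℕ.+ u)                                    ≈⟨ mod-Σ q (λ i _ → mod-*ˡ (+ weight i) (lucas-shifted d u (q ∸ suc i) u<p)) ⟩
      Σ< q (λ i → + weight i * (+ u * Bℤ d (q ∸ suc i)))    ≡⟨ Σ-ext q (λ i _ → commute (+ weight i) (+ u) (Bℤ d (q ∸ suc i))) ⟩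
      Σ< q (λ i → + u * (+ weight i * Bℤ d (q ∸ suc i)))    ≡⟨ Σ-*ˡ q (+ u) _ ⟩
      + u * S d                                            ∎
      where
      open mod-Reasoning (+ p)
      commute : ∀ w u c → w * (u * c) ≡ u * (w * c)
      commute = solve-∀

    base-from : ∀ d → ¬ + p ∣ S d → ¬ + p ∣ Bℤ d q → ∀ r → ¬ + p ∣ r → ∃ λ n → Liftable n × Bℤ n k ≡ r mod + p
    base-from d p∤S p∤C r p∤r with residue (+ ratio r (Bℤ d q))
    ... | zero  , _   , s≡0 = ⊥-elim (p∤r (∣-resp-≡ r≡0 (divides 0ℤ refl)))
      where r≡0 = mod-trans (mod-sym (ratio-spec r (Bℤ d q) p∤C)) (mod-*ʳ (Bℤ d q) s≡0)
    ... | suc u , u<p , s≡u = d ℕ.* P ℕ.+ suc u , liftable , C≡r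
      where
      open mod-Reasoning (+ p)
      liftable : Liftable (d ℕ.* P ℕ.+ suc u)
      liftable p∣Z = p∤* (p∤small (s≤s z≤n) u<p) p∤S (∣-resp-≡ (mod-sym (Z-lucas d (suc u) u<p)) p∣Z)
      C≡r : Bℤ (d ℕ.* P ℕ.+ suc u) k ≡ r mod + p
      C≡r = begin
        Bℤ (d ℕ.* P ℕ.+ suc u) k              ≡⟨ cong (Bℤ (d ℕ.* P ℕ.+ suc u)) k≡1+qP ⟩
        Bℤ (d ℕ.* P ℕ.+ suc u) (suc (q ℕ.* P)) ≈⟨ lucas-shifted d (suc u) q u<p ⟩
        + suc u * Bℤ d q                      ≈⟨ mod-*ʳ (Bℤ d q) (mod-sym s≡u) ⟩
        + ratio r (Bℤ d q) * Bℤ d q           ≈⟨ ratio-spec r (Bℤ d q) p∤C ⟩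
        r                                     ∎

    -- The harmonic step:  S (q+1) - (q+1) S q ≡ -q,  so S q and S (q+1) are not both divisible by p.
    harmonic-difference : S (suc q) - + suc q * S q ≡ - + q mod + p
    harmonic-difference = begin
      S (suc q) - + suc q * S q
        ≡⟨ sym (Σ-combination q (+ suc q) _ _) ⟩
      Σ< q (λ i → + weight i * Bℤ (suc q) (q ∸ suc i) - + suc q * (+ weight i * Bℤ q (q ∸ suc i)))
        ≡⟨ Σ-ext q (λ i i<q → trans (factor (+ weight i) _ (+ suc q) _) (cong (+ weight i *_) (symmetric-absorption q i i<q))) ⟩
      Σ< q (λ i → + weight i * - (+ suc i * Bℤ (suc q) (suc (suc i))))
        ≈⟨ mod-Σ q (λ i i<q → mod-trans (mod-reflexive (reassociate (+ weight i) (+ suc i) _))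
                                       (mod-neg (mod-*ʳ (Bℤ (suc q) (suc (suc i))) (weight-spec i i<q)))) ⟩
      Σ< q (λ i → - (sign i * Bℤ (suc q) (suc (suc i))))
        ≡⟨ trans (Σ-neg q _) (cong -_ (alternating-tail q)) ⟩
      - + q
        ∎
      where
      open mod-Reasoning (+ p)
      factor : ∀ w A c B → w * A - c * (w * B) ≡ w * (A - c * B)
      factor = solve-∀
      reassociate : ∀ w s C → w * - (s * C) ≡ - (w * s * C)
      reassociate = solve-∀

    harmonic : + p ∣ S q → ¬ + p ∣ S (suc q)
    harmonic p∣Sq p∣Sq+1 = p∤small 1≤q (ℕP.<-trans (ℕP.n<1+n q) q+1<p) (subst (+ p ∣_) (ℤP.neg-involutive (+ q)) (∣m⇒∣-m p∣-q))
      where p∣-q = ∣-resp-≡ (mod-sym harmonic-difference) (∣m∣n⇒∣m-n p∣Sq+1 (∣n⇒∣m*n (+ suc q) p∣Sq))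

    base : ∀ r → ∃ λ n → Liftable n × Bℤ n k ≡ r mod + p
    base r with + p ∣? r
    ... | yes p∣r = 1 , liftable-1 , mod-trans (mod-reflexive (cong +_ C[1,k]≡0)) (mod-sym (∣⇒≡0 p∣r))
    ... | no  p∤r with + p ∣? S q
    ...   | no  p∤Sq = base-from q p∤Sq (λ p∣C → p∤1 (subst (+ p ∣_) (cong +_ (B-diag q)) p∣C)) r p∤r
    ...   | yes p∣Sq = base-from (suc q) (harmonic p∣Sq) p∤C r p∤r
      where
      C[q+1,q]≡q+1 = trans (B-sym (ℕP.n≤1+n q)) (trans (cong (B (suc q)) (ℕP.m+n∸n≡m 1 q)) (B-one (suc q)))
      p∤C = λ p∣C → p∤small (s≤s z≤n) q+1<p (subst (+ p ∣_) (cong +_ C[q+1,q]≡q+1) p∣C)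

    -- Lifting.  If p^(c+a) ∣ M, Vandermonde's sum for C(M + n, k) modulo p^(c+1) reduces to the
    -- indices j = i P (i ≤ q), since p^(c+1) ∣ C(M, j) whenever P ∤ j.
    expand : ∀ c M n → p ^ (c ℕ.+ a) ℕD.∣ M →
      Bℤ (M ℕ.+ n) k ≡ Σ< (suc q) (λ i → Bℤ M (i ℕ.* P) * Bℤ n (k ∸ i ℕ.* P)) mod + (p ^ suc c)
    expand c M n pᶜ⁺ᵃ∣M = begin
      Bℤ (M ℕ.+ n) k          ≡⟨ vandermonde M n k ⟩
      Σ< (suc k) g            ≈⟨ Σ-collapse (suc k) (suc q) (ℕ._* P) g injective ι<k+1 split ⟩
      Σ< (suc q) (g ∘ (ℕ._* P)) ∎
      where
      open mod-Reasoning (+ (p ^ suc c))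
      g : ℕ → ℤ
      g j = Bℤ M j * Bℤ n (k ∸ j)
      injective : ∀ {i i′} → i < suc q → i′ < suc q → i ℕ.* P ≡ i′ ℕ.* P → i ≡ i′
      injective {i} {i′} _ _ = ℕP.*-cancelʳ-≡ i i′ P
      qP≤k : q ℕ.* P ≤ k
      qP≤k = subst (q ℕ.* P ≤_) (sym k≡1+qP) (ℕP.n≤1+n (q ℕ.* P))
      ι<k+1 : ∀ i → i < suc q → i ℕ.* P < suc k
      ι<k+1 i i<q+1 = s≤s (ℕP.≤-trans (ℕP.*-monoˡ-≤ P (ℕP.≤-pred i<q+1)) qP≤k)
      split : ∀ j → j < suc k →
        (∃ λ i → i < suc q × j ≡ i ℕ.* P) ⊎ ((∀ i → i < suc q → ¬ j ≡ i ℕ.* P) × g j ≡ 0ℤ mod + (p ^ suc c))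
      split j j<k+1 with P ℕD.∣? j
      ... | yes (ℕD.divides i₀ refl) =
        inj₁ (i₀ , s≤s (multiple-index-≤ i₀ q (subst (i₀ ℕ.* P ≤_) k≡1+qP (ℕP.≤-pred j<k+1))) , refl)
      ... | no  P∤j = inj₂ (outside , ∣⇒≡0 (∣m⇒∣m*n (Bℤ n (k ∸ j)) (∣ᵤ⇒∣ {+ (p ^ suc c)} {Bℤ M j} (binomial-divisible c a M j pᶜ⁺ᵃ∣M 0<j P∤j))))
        where
        outside = λ i _ j≡iP → P∤j (subst (P ℕD.∣_) (sym j≡iP) (ℕD.n∣m*n i))
        0<j = ℕP.n≢0⇒n>0 (λ j≡0 → P∤j (subst (P ℕD.∣_) (sym j≡0) (ℕD._∣0 P)))

    module TopCoefficient (c s : ℕ) (0<s : 0 < s) (i : ℕ) (i<q : i < q) where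

      N = suc c ℕ.+ a
      M = p ^ N ℕ.* s
      j = suc i ℕ.* P

      instance
        M≢0 : NonZero M
        M≢0 = ℕP.m*n≢0 (p ^ N) s {{ℕP.m^n≢0 p N}} {{ℕ.>-nonZero 0<s}}
        j≢0 : NonZero j
        j≢0 = ℕP.m*n≢0 (suc i) P

      -- v_p(j) = a exactly, since p ∤ i + 1; hence p^(c+1) ∣ C(M, j).
      pᶜ⁺¹∣C : p ^ suc c ℕD.∣ B M j
      pᶜ⁺¹∣C = binomial-divisible c (suc a) M j (subst (λ t → p ^ t ℕD.∣ M) (sym (ℕP.+-suc c a)) (ℕD.m∣m*n s))
                 (ℕ.>-nonZero⁻¹ j) pᵃ⁺¹∤j
        where pᵃ⁺¹∤j = λ pᵃ⁺¹∣j → ℕD.>⇒∤ (ℕP.≤-trans (s≤s i<q) (ℕP.<⇒≤ q+1<p)) (ℕD.*-cancelʳ-∣ P pᵃ⁺¹∣j)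

      Y : ℕ
      Y = ℕD.quotient pᶜ⁺¹∣C

      C≡Y·pᶜ⁺¹ : B M j ≡ Y ℕ.* p ^ suc c
      C≡Y·pᶜ⁺¹ = ℕD._∣_.equality pᶜ⁺¹∣C

      -- Absorption  j C(M, j) = M C(M-1, j-1)  divided by  p^(c+1) P:  (i+1) Y = s C(M-1, j-1).
      U : ℕ
      U = B (M ∸ 1) (j ∸ 1)

      [i+1]Y≡sU : suc i ℕ.* Y ≡ s ℕ.* U
      [i+1]Y≡sU = ℕP.*-cancelʳ-≡ (suc i ℕ.* Y) (s ℕ.* U) (p ^ suc c ℕ.* P) {{ℕP.m*n≢0 (p ^ suc c) P {{ℕP.m^n≢0 p (suc c)}}}} (begin
        suc i ℕ.* Y ℕ.* (p ^ suc c ℕ.* P)   ≡⟨ regroup₁ (suc i) Y (p ^ suc c) P ⟩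
        j ℕ.* (Y ℕ.* p ^ suc c)             ≡⟨ cong (j ℕ.*_) (sym C≡Y·pᶜ⁺¹) ⟩
        j ℕ.* B M j                        ≡⟨ absorb ⟩
        M ℕ.* U                            ≡⟨ cong (λ t → t ℕ.* s ℕ.* U) (ℕP.^-distribˡ-+-* p (suc c) a) ⟩
        p ^ suc c ℕ.* P ℕ.* s ℕ.* U         ≡⟨ regroup₂ (p ^ suc c ℕ.* P) s U ⟩
        s ℕ.* U ℕ.* (p ^ suc c ℕ.* P)       ∎)
        where
        open ≡-Reasoning
        absorb : j ℕ.* B M j ≡ M ℕ.* U
        absorb = subst₂ (λ u v → u ℕ.* B v u ≡ v ℕ.* U) (ℕP.suc-pred j) (ℕP.suc-pred M) (B-absorb (M ∸ 1) (j ∸ 1))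
        regroup₁ : ∀ I Y C P → I ℕ.* Y ℕ.* (C ℕ.* P) ≡ I ℕ.* P ℕ.* (Y ℕ.* C)
        regroup₁ = NatSolver.solve-∀
        regroup₂ : ∀ Q s U → Q ℕ.* s ℕ.* U ≡ s ℕ.* U ℕ.* Q
        regroup₂ = NatSolver.solve-∀

      -- M is a multiple of p^N and j - 1 < k < p^N, so C(M-1, j-1) ≡ (-1)^(j-1) = (-1)^i.
      U≡sign : + U ≡ sign i mod + p
      U≡sign = mod-trans (row-below-multiple N (M ∸ 1) (j ∸ 1) pᴺ∣M j∸1<pᴺ) (mod-reflexive sign[j-1]≡sign)
        where
        pᴺ∣M = subst (p ^ N ℕD.∣_) (sym (ℕP.suc-pred M)) (ℕD.m∣m*n s)
        j∸1<pᴺ = ℕP.≤-trans (ℕP.≤-reflexive (ℕP.suc-pred j))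
                   (ℕP.≤-trans (ℕP.*-monoˡ-≤ P i<q) (ℕP.≤-trans (ℕP.n≤1+n (q ℕ.* P))
                     (ℕP.≤-trans (ℕP.≤-reflexive (sym k≡1+qP)) (ℕP.≤-trans (ℕP.<⇒≤ k<p^[a+1])
                       (ℕP.^-monoʳ-≤ p (s≤s (ℕP.m≤n+m a c)))))))
        sign[j-1]≡sign = trans (cong (λ t → sign (suc i ℕ.* t ∸ 1)) (sym (ℕP.suc-pred P)))
                               (sign-multiple-1 {P ∸ 1} (trans (cong sign (ℕP.suc-pred P)) (sign-^-odd p-odd a)) i)

      Y≡s·w : + Y ≡ + s * + weight i mod + p
      Y≡s·w = cancel (+ suc i) (p∤i+1 i i<q) (begin
        + suc i * + Y                  ≡⟨ trans (sym (ℤP.pos-* (suc i) Y)) (trans (cong +_ [i+1]Y≡sU) (ℤP.pos-* s U)) ⟩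
        + s * + U                      ≈⟨ mod-*ˡ (+ s) U≡sign ⟩
        + s * sign i                   ≈⟨ mod-*ˡ (+ s) (mod-sym (weight-spec i i<q)) ⟩
        + s * (+ weight i * + suc i)   ≡⟨ rearrange (+ s) (+ weight i) (+ suc i) ⟩
        + suc i * (+ s * + weight i)   ∎)
        where
        open mod-Reasoning (+ p)
        rearrange : ∀ s w i → s * (w * i) ≡ i * (s * w)
        rearrange = solve-∀

    lift-expansion : ∀ c s n → 0 < s →
      Bℤ (p ^ (suc c ℕ.+ a) ℕ.* s ℕ.+ n) k ≡ Bℤ n k + + (p ^ suc c) * (+ s * Z n) mod + (p ^ suc (suc c))
    lift-expansion c s n 0<s = begin
      Bℤ (M ℕ.+ n) k
        ≈⟨ expand (suc c) M n (ℕD.m∣m*n s) ⟩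
      Σ< (suc q) (λ i → Bℤ M (i ℕ.* P) * Bℤ n (k ∸ i ℕ.* P))
        ≡⟨ Σ-shift q _ ⟩
      1ℤ * Bℤ n k + Σ< q (λ i → Bℤ M (suc i ℕ.* P) * Bℤ n (k ∸ suc i ℕ.* P))
        ≈⟨ mod-+ (mod-reflexive (ℤP.*-identityˡ (Bℤ n k))) (mod-Σ q term) ⟩
      Bℤ n k + Σ< q (λ i → pᶜ⁺¹ * (+ s * (+ weight i * Bℤ n (κ i))))
        ≡⟨ cong (_+_ (Bℤ n k)) (trans (Σ-*ˡ q pᶜ⁺¹ _) (cong (pᶜ⁺¹ *_) (Σ-*ˡ q (+ s) _))) ⟩
      Bℤ n k + pᶜ⁺¹ * (+ s * Z n)
        ∎
      where
      open mod-Reasoning (+ (p ^ suc (suc c)))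
      M = p ^ (suc c ℕ.+ a) ℕ.* s
      pᶜ⁺¹ = + (p ^ suc c)
      term : ∀ i → i < q → Bℤ M (suc i ℕ.* P) * Bℤ n (k ∸ suc i ℕ.* P) ≡ pᶜ⁺¹ * (+ s * (+ weight i * Bℤ n (κ i))) mod + (p ^ suc (suc c))
      term i i<q = begin
        Bℤ M (suc i ℕ.* P) * Bℤ n (k ∸ suc i ℕ.* P)     ≡⟨ cong₂ (λ u v → + u * Bℤ n v) C≡Y·pᶜ⁺¹ (k∸[i+1]P≡κ i i<q) ⟩
        + (Y ℕ.* p ^ suc c) * Bℤ n (κ i)                ≡⟨ trans (cong (_* Bℤ n (κ i)) (ℤP.pos-* Y (p ^ suc c))) (regroup (+ Y) pᶜ⁺¹ (Bℤ n (κ i))) ⟩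
        pᶜ⁺¹ * (+ Y * Bℤ n (κ i))                       ≈⟨ mod-modulus (p^c·p≡p^[c+1] p (suc c)) (mod-scale pᶜ⁺¹ (mod-*ʳ (Bℤ n (κ i)) Y≡s·w)) ⟩
        pᶜ⁺¹ * (+ s * + weight i * Bℤ n (κ i))          ≡⟨ cong (pᶜ⁺¹ *_) (ℤP.*-assoc (+ s) (+ weight i) (Bℤ n (κ i))) ⟩
        pᶜ⁺¹ * (+ s * (+ weight i * Bℤ n (κ i)))        ∎
        where
        open TopCoefficient c s 0<s i i<q using (Y; C≡Y·pᶜ⁺¹; Y≡s·w)
        regroup : ∀ Y C x → Y * C * x ≡ C * (Y * x)
        regroup = solve-∀

    -- One lifting step: every residue mod p^(c+1) attained by a liftable n yields every residue
    -- mod p^(c+2), choosing s with  s Z n ≡ -(C(n, k) - r)/p^(c+1)  (mod p).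
    lift-step : ∀ c → (∀ r → ∃ λ n → Liftable n × Bℤ n k ≡ r mod + (p ^ suc c))
                    → (∀ r → ∃ λ n → Liftable n × Bℤ n k ≡ r mod + (p ^ suc (suc c)))
    lift-step c attained r with attained r
    ... | n , n-liftable , ≡-mod (divides t C-r≡t·pᶜ⁺¹) = M ℕ.+ n , liftable-stable M n pᵃ⁺¹∣M n-liftable , (begin
      Bℤ (M ℕ.+ n) k                          ≈⟨ lift-expansion c s n 0<s ⟩
      Bℤ n k + pᶜ⁺¹ * (+ s * Z n)              ≡⟨ regroup (Bℤ n k) r pᶜ⁺¹ (+ s * Z n) ⟩
      r + ((Bℤ n k - r) + pᶜ⁺¹ * (+ s * Z n))  ≡⟨ cong (λ x → r + (x + pᶜ⁺¹ * (+ s * Z n))) C-r≡t·pᶜ⁺¹ ⟩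
      r + (t * pᶜ⁺¹ + pᶜ⁺¹ * (+ s * Z n))      ≈⟨ mod-+ (mod-reflexive {x = r} refl) (∣⇒≡0 p^[c+2]∣) ⟩
      r + 0ℤ                                  ≡⟨ ℤP.+-identityʳ r ⟩
      r                                       ∎)
      where
      open mod-Reasoning (+ (p ^ suc (suc c)))
      pᶜ⁺¹ = + (p ^ suc c)
      s = ratio (- t) (Z n) ℕ.+ p
      0<s = ℕP.<-≤-trans (ℕ.>-nonZero⁻¹ p) (ℕP.m≤n+m p _)
      M = p ^ (suc c ℕ.+ a) ℕ.* s
      pᵃ⁺¹∣M = ℕD.∣-trans (^-monoʳ-∣ p (s≤s (ℕP.m≤n+m a c))) (ℕD.m∣m*n s)
      -- s ≡ ratio (-t) (Z n) (mod p), hence  t + s Z n ≡ 0 (mod p)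
      t+sZ≡0 : t + + s * Z n ≡ 0ℤ mod + p
      t+sZ≡0 = mod-trans (mod-+ (mod-reflexive {x = t} refl)
                   (mod-trans (mod-reflexive (trans (cong (_* Z n) (ℤP.pos-+ (ratio (- t) (Z n)) p)) (ℤP.*-distribʳ-+ (Z n) (+ ratio (- t) (Z n)) (+ p))))
                   (mod-trans (mod-+ (ratio-spec (- t) (Z n) n-liftable) (∣⇒≡0 (∣m⇒∣m*n (Z n) ∣-refl)))
                              (mod-reflexive (ℤP.+-identityʳ (- t))))))
                 (mod-reflexive (ℤP.+-inverseʳ t))
      p^[c+2]∣ : + (p ^ suc (suc c)) ∣ t * pᶜ⁺¹ + pᶜ⁺¹ * (+ s * Z n)
      p^[c+2]∣ = subst₂ _∣_ (p^c·p≡p^[c+1] p (suc c)) (factor t pᶜ⁺¹ (+ s * Z n))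
                   (*-monoʳ-∣ pᶜ⁺¹ (_≡_mod_.difference t+sZ≡0))
        where factor : ∀ t C X → C * (t + X - 0ℤ) ≡ t * C + C * X
              factor = solve-∀
      regroup : ∀ B r C X → B + C * X ≡ r + ((B - r) + C * X)
      regroup = solve-∀

    universal-mod-powers : ∀ e r → ∃ λ n → Liftable n × Bℤ n k ≡ r mod + (p ^ suc e)
    universal-mod-powers zero    r with base r
    ... | n , n-liftable , C≡r = n , n-liftable , mod-modulus (cong +_ (sym (ℕP.*-identityʳ p))) C≡r
    universal-mod-powers (suc e) = lift-step e (universal-mod-powers e)

    k-universal : ∀ b → Universal k (p ^ b) {{ℕP.m^n≢0 p b}}
    k-universal zero    zero    _         = 0 , n%1≡0 (0 C k)
    k-universal zero    (suc r) (s≤s ())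
    k-universal (suc e) r       r<p^[e+1] =
      let n , _ , C≡r = universal-mod-powers e (+ r)
      in  n , trans (cong (λ x → ℕ._%_ x (p ^ suc e) {{pᵉ⁺¹≢0}}) (sym (B≡C n k)))
                    (mod⇒% (p ^ suc e) {{pᵉ⁺¹≢0}} (B n k) r C≡r r<p^[e+1])
      where pᵉ⁺¹≢0 = ℕP.m^n≢0 p (suc e)

  q+1<p : ∀ {p q} .{{_ : NonZero p}} → 1 ≤ q → q ≤ (p ∸ 1) ℕ./ 2 → suc q < p
  q+1<p {p} {q} 1≤q q≤[p-1]/2 = ℕP.≤-trans (s≤s (ℕP.≤-trans q+1≤2q 2q≤p-1)) (ℕP.≤-reflexive (ℕP.suc-pred p))
    where
    q+1≤2q = ℕP.≤-trans (ℕP.+-monoˡ-≤ q 1≤q) (ℕP.≤-reflexive (double q))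
      where double : ∀ q → q ℕ.+ q ≡ q ℕ.* 2
            double = NatSolver.solve-∀
    2q≤p-1 = ℕP.≤-trans (ℕP.*-monoˡ-≤ 2 q≤[p-1]/2) (m/n*n≤m (p ∸ 1) 2)

open import Defs
open import Data.Nat using (ℕ; _+_; _*_; _^_; _≤_; _/_; _∸_)
open import Data.Nat.Properties using (m^n≢0)
open import Data.Nat.Primality using (Prime; prime⇒nonZero)
open import Data.Empty using (⊥)
open import Relation.Binary.PropositionalEquality using (_≡_)
open BinomialUniversality using (module Universality; module ModPrime; q+1<p)

corollary1p3 : (p : ℕ) → (pp : Prime p) → (p ≡ 2 → ⊥) → (q : ℕ) → 1 ≤ q → q ≤ (p ∸ 1) / 2 → (a b : ℕ) → 1 ≤ a →
    Universal (p ^ a * q + 1) (p ^ b) {{m^n≢0 p b {{prime⇒nonZero pp}}}}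
corollary1p3 p p-prime p≢2 q 1≤q q≤[p-1]/2 a b 1≤a =
  Universality.k-universal p p-prime (ModPrime.odd-prime-sign p p-prime p≢2) q 1≤q (q+1<p {{prime⇒nonZero p-prime}} 1≤q q≤[p-1]/2) a 1≤a b
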